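{- For each pPDA $\Delta=(Q,\Gamma,\delta,\mathit{Prob})$ and regular sets $\mathcal{C}_1,\dots,\mathcal{C}_k\subseteq\mathcal{C}(\Delta)$ there effectively exist a pPDA $\Delta'=(Q,\Gamma',\delta',\mathit{Prob}')$ (with the same control states), simple sets $\mathcal{C}'_1,\dots,\mathcal{C}'_k\subseteq\mathcal{C}(\Delta')$, and an injective mapping $\mathcal{G}:\mathcal{C}(\Delta)\to\mathcal{C}(\Delta')$ such that for every $p\alpha\in\mathcal{C}(\Delta)$: (1) for each $1\le j\le k$, $p\alpha\in\mathcal{C}_j$ iff $\mathcal{G}(p\alpha)\in\mathcal{C}'_j$; (2) if $p\alpha\xrightarrow{x}q\beta$ then $\mathcal{G}(p\alpha)\xrightarrow{x}\mathcal{G}(q\beta)$; (3) if $\mathcal{G}(p\alpha)\xrightarrow{x}s$ for some $s\in\mathcal{C}(\Delta')$, then there is a transition $p\alpha\xrightarrow{x}q\beta$ with $\mathcal{G}(q\beta)=s$. Moreover, if $\mathcal{C}\subseteq\mathcal{C}(\Delta')$ is regular, then $\mathcal{G}^{ -1}(\mathcal{C})$ is regular.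
   Context: A pPDA $\Delta=(Q,\Gamma,\delta,\mathit{Prob})$: finite control states $Q$, finite stack alphabet $\Gamma$, finite rules $pX\to q\alpha$ ($\alpha\in\Gamma^*$) with probabilities in $(0,1]$ summing to $0$ or $1$ for each $pX$. $\mathcal{C}(\Delta)=Q\times\Gamma^*$ is the set of configurations $p\alpha$ (top of stack leftmost); $p\alpha\xrightarrow{x}q\beta$ denotes a transition of the associated transition system, where $pX\gamma\xrightarrow{x}q\alpha\gamma$ iff $pX\xrightarrow{x}q\alpha$ is a rule and $\gamma\in\Gamma^*$. A $\Delta$-automaton is $(\mathit{St},\gamma,\mathit{Acc})$ with finite $\mathit{St}\supseteq Q$, total $\gamma:\mathit{St}\times\Gamma\to\mathit{St}$ (extended to words), $\mathit{Acc}\subseteq\mathit{St}$; it recognizes $\{p\alpha\mid\gamma(p,\alpha^R)\in\mathit{Acc}\}$ where $\alpha^R$ is the reverse of $\alpha$. Regular sets of configurations are those recognized by some $\Delta$-automaton. A set $\mathcal{C}$ of configurations is simple if there is $G\subseteq Q\times(\Gamma\cup\{\varepsilon\})$ with $p\alpha\in\mathcal{C}$ iff ($\alpha=\varepsilon$ and $p\varepsilon\in G$) or ($\alpha=X\beta$ and $pX\in G$). -}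

module Defs where

open import Data.Nat using (ℕ)
open import Data.Fin using (Fin)
open import Data.Fin.Properties using () renaming (_≟_ to _≟ᶠ_)
open import Data.Bool using (Bool; true; false; _∧_)
open import Data.Maybe using (Maybe; just; nothing)
open import Data.List using (List; []; _∷_; _++_; foldl; foldr; filter; reverse)
open import Data.List.Membership.Propositional using (_∈_)
open import Data.List.Relation.Unary.Unique.Propositional using (Unique)
open import Data.Product using (Σ; _×_; _,_; ∃)
open import Data.Sum using (_⊎_; inj₁; inj₂)
open import Data.Rational using (ℚ; 0ℚ; 1ℚ; _+_; _<_; _≤_)
open import Relation.Binary.PropositionalEquality using (_≡_)
open import Relation.Nullary using (does; _×-dec_)
open import Relation.Nullary.Decidable using (⌊_⌋)
open import Function.Bundles using (_⇔_)
open import Function.Definitions using (Injective)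

-- A rule  pX → qα  (α a word over the stack alphabet, leftmost = top).
record Rule (n m : ℕ) : Set where
  constructor rule
  field
    src  : Fin n
    top  : Fin m
    tgt  : Fin n
    push : List (Fin m)

rulesFrom : ∀ {n m} → List (Rule n m) → Fin n → Fin m → List (Rule n m)
rulesFrom δ p X = filter (λ r → (Rule.src r ≟ᶠ p) ×-dec (Rule.top r ≟ᶠ X)) δ

sumℚ : List ℚ → ℚ
sumℚ = foldr _+_ 0ℚ

record PPDA (n m : ℕ) : Set where
  field
    δ        : List (Rule n m)
    δ-unique : Unique δ
    Prob     : Rule n m → ℚ
    Prob-pos : ∀ r → r ∈ δ → 0ℚ < Prob r
    Prob-le1 : ∀ r → r ∈ δ → Prob r ≤ 1ℚ
    Prob-sum : ∀ p X → let s = sumℚ (Data.List.map Prob (rulesFrom δ p X))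
                       in (s ≡ 0ℚ) ⊎ (s ≡ 1ℚ)

Config : ℕ → ℕ → Set
Config n m = Fin n × List (Fin m)

data Step {n m : ℕ} (Δ : PPDA n m) : Config n m → ℚ → Config n m → Set where
  step : ∀ {p X q α} (γ : List (Fin m)) →
         rule p X q α ∈ PPDA.δ Δ →
         Step Δ (p , X ∷ γ) (PPDA.Prob Δ (rule p X q α)) (q , α ++ γ)

-- A Δ-automaton (St, γ, Acc): St = Q ⊎ Fin e (so St ⊇ Q), γ total, Acc ⊆ St.
record Automaton (n m : ℕ) : Set where
  field
    extra : ℕ
    trans : (Fin n ⊎ Fin extra) → Fin m → (Fin n ⊎ Fin extra)
    Acc   : (Fin n ⊎ Fin extra) → Bool

  run : (Fin n ⊎ Fin extra) → List (Fin m) → (Fin n ⊎ Fin extra)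
  run = foldl trans

Recognizes : ∀ {n m} → Automaton n m → Config n m → Set
Recognizes A (p , α) = Automaton.Acc A (Automaton.run A (inj₁ p) (reverse α)) ≡ true

Regular : ∀ {n m} → (Config n m → Set) → Set
Regular {n} {m} C = Σ (Automaton n m) λ A → ∀ c → C c ⇔ Recognizes A c

-- The simple set determined by G ⊆ Q × (Γ ∪ {ε}) (ε encoded as nothing).
SimpleSet : ∀ {n m} → (Fin n → Maybe (Fin m) → Bool) → Config n m → Set
SimpleSet G (p , [])    = G p nothing ≡ true
SimpleSet G (p , X ∷ β) = G p (just X) ≡ true

{-# OPTIONS --safe #-}
module Submission where

-- Annotate every stack symbol with the vector of states that each automaton A_j,
-- started in each control state r, reaches after reading the part of the stack
-- below that symbol.  These vectors are computed bottom-up by a finite deterministic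
-- automaton, so a rule pX → qα lifts, for each annotation a of X, to a rule that
-- pushes α annotated from a; the annotated pPDA simulates the original one step for
-- step.  Membership in C_j is then decided by the control state and the annotated top
-- symbol alone (a simple set), and an automaton for annotated configurations is
-- simulated on plain ones by running it in parallel with the annotating automaton.

open import Defs
open import Data.Nat using (ℕ; zero; suc; _+_; _*_)
open import Data.Fin using (Fin; zero; suc)
open import Data.Fin.Properties using (+↔⊎; *↔×; 1↔⊤) renaming (_≟_ to _≟ᶠ_)
open import Data.Bool using (Bool; true)
open import Data.Maybe as Maybe using (Maybe; just; nothing)
open import Data.Rational using (ℚ; 0ℚ; 1ℚ)
open import Data.Product using (Σ; _×_; _,_; proj₁; proj₂)
open import Data.Product.Properties using (,-injective)
open import Data.Product.Function.NonDependent.Propositional using (_×-↔_)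
open import Data.Sum using (_⊎_; inj₁; inj₂)
open import Data.Unit using (⊤; tt)
open import Data.List using (List; []; _∷_; [_]; _++_; map; filter; foldl; reverse; allFin; cartesianProductWith)
open import Data.List.Properties using (filter-++; filter-none; filter-accept; filter-reject; map-++; map-∘; map-cong; foldl-∷ʳ; unfold-reverse)
open import Data.List.Membership.Propositional using (_∈_)
open import Data.List.Membership.Propositional.Properties using (∈-map⁺; ∈-allFin; ∈-cartesianProductWith⁺; ∈-cartesianProductWith⁻)
open import Data.List.Relation.Unary.Any using (here; there)
open import Data.List.Relation.Unary.All as All using ()
open import Data.List.Relation.Unary.All.Properties as All using ()
open import Data.List.Relation.Unary.AllPairs using (_∷_)
open import Data.List.Relation.Unary.Unique.Propositional using (Unique)
import Data.List.Relation.Unary.Unique.Propositional.Properties as Unique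
open import Relation.Binary.PropositionalEquality using (_≡_; refl; sym; trans; cong; cong₂; subst; subst₂; module ≡-Reasoning)
open import Relation.Nullary using (yes; no; _×-dec_)
open import Relation.Unary using (Decidable)
open import Function using (_∘_)
open import Function.Bundles using (_⇔_; _↔_; Inverse; Injection)
open import Function.Definitions using (Injective)
open import Function.Properties.Inverse using (↔-refl; ↔-sym; ↔-trans; ↔⇒↣)

open ≡-Reasoning

index-× : ∀ {A B : Set} {a b} → A ↔ Fin a → B ↔ Fin b → (A × B) ↔ Fin (a * b)
index-× f g = ↔-trans (f ×-↔ g) (↔-sym *↔×)

module _ {A B : Set} {P : B → Set} (P? : Decidable P) (f : A → B) where

  filter-map-unique : ∀ {x xs} → Unique xs → x ∈ xs →
                      (∀ {y} → P (f y) → y ≡ x) → P (f x) →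
                      filter P? (map f xs) ≡ [ f x ]
  filter-map-unique {xs = _ ∷ ys} (x≢ ∷ _) (here refl) only Pfx = begin
    filter P? (f _ ∷ map f ys)   ≡⟨ filter-accept P? Pfx ⟩
    f _ ∷ filter P? (map f ys)   ≡⟨ cong (f _ ∷_) (filter-none P? (All.map⁺ (All.map (λ x≢y Pfy → x≢y (sym (only Pfy))) x≢))) ⟩
    [ f _ ]                      ∎
  filter-map-unique (y≢ ∷ u) (there x∈) only Pfx =
    trans (filter-reject P? (λ Pfy → All.lookup y≢ x∈ (only Pfy))) (filter-map-unique u x∈ only Pfx)

run-reverse-∷ : ∀ {n m} (A : Automaton n m) s X β →
                Automaton.run A s (reverse (X ∷ β)) ≡ Automaton.trans A (Automaton.run A s (reverse β)) X
run-reverse-∷ A s X β = trans (cong (foldl (Automaton.trans A) s) (unfold-reverse X β))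
                              (foldl-∷ʳ (Automaton.trans A) s X (reverse β))

record DFA (m : ℕ) : Set₁ where
  field
    State : Set
    size  : ℕ
    index : State ↔ Fin size
    start : State
    next  : State → Fin m → State

  readFrom : State → List (Fin m) → State
  readFrom s []      = s
  readFrom s (X ∷ β) = next (readFrom s β) X

  read : List (Fin m) → State
  read = readFrom start

  readFrom-++ : ∀ s α γ → readFrom s (α ++ γ) ≡ readFrom (readFrom s γ) α
  readFrom-++ s []      γ = refl
  readFrom-++ s (X ∷ α) γ = cong (λ t → next t X) (readFrom-++ s α γ)

  peek : List (Fin m) → Maybe (Fin m × State)
  peek []      = nothing
  peek (X ∷ β) = just (X , read β)

module _ {m : ℕ} where
  open DFA

  trivialDFA : DFA m
  trivialDFA = record { State = ⊤ ; size = 1 ; index = ↔-sym 1↔⊤ ; start = tt ; next = λ _ _ → tt }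

  _⊗_ : DFA m → DFA m → DFA m
  M ⊗ N = record
    { State = State M × State N
    ; size  = size M * size N
    ; index = index-× (index M) (index N)
    ; start = start M , start N
    ; next  = λ (s , t) X → next M s X , next N t X
    }

  read-⊗ : ∀ M N β → read (M ⊗ N) β ≡ (read M β , read N β)
  read-⊗ M N []      = refl
  read-⊗ M N (X ∷ β) = cong (λ (s , t) → next M s X , next N t X) (read-⊗ M N β)

  ⨂ : ∀ {k} → (Fin k → DFA m) → DFA m
  ⨂ {zero}  M = trivialDFA
  ⨂ {suc k} M = M zero ⊗ ⨂ (M ∘ suc)

  component : ∀ {k} (M : Fin k → DFA m) j → State (⨂ M) → State (M j)
  component M zero    (s , _) = s
  component M (suc j) (_ , t) = component (M ∘ suc) j t

  read-⨂ : ∀ {k} (M : Fin k → DFA m) j β → component M j (read (⨂ M) β) ≡ read (M j) β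
  read-⨂ M zero    β = cong proj₁ (read-⊗ (M zero) (⨂ (M ∘ suc)) β)
  read-⨂ M (suc j) β = trans (cong (component (M ∘ suc) j ∘ proj₂) (read-⊗ (M zero) (⨂ (M ∘ suc)) β))
                             (read-⨂ (M ∘ suc) j β)

startedAt : ∀ {n m} (A : Automaton n m) → Fin n ⊎ Fin (Automaton.extra A) → DFA m
startedAt A s = record { State = _ ; size = _ ; index = ↔-sym +↔⊎ ; start = s ; next = Automaton.trans A }

read-startedAt : ∀ {n m} (A : Automaton n m) s β →
                 DFA.read (startedAt A s) β ≡ Automaton.run A s (reverse β)
read-startedAt A s []      = refl
read-startedAt A s (X ∷ β) = begin
  Automaton.trans A (DFA.read (startedAt A s) β) X   ≡⟨ cong (λ t → Automaton.trans A t X) (read-startedAt A s β) ⟩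
  Automaton.trans A (Automaton.run A s (reverse β)) X ≡⟨ sym (run-reverse-∷ A s X β) ⟩
  Automaton.run A s (reverse (X ∷ β))                 ∎

module Annotation {n m : ℕ} (Δ : PPDA n m) (R : DFA m) where
  open PPDA Δ
  open DFA R

  m′ : ℕ
  m′ = m * size

  symbolIndex : (Fin m × State) ↔ Fin m′
  symbolIndex = index-× ↔-refl index

  open Inverse symbolIndex public using () renaming (to to encode; from to decode)

  decode-encode : ∀ x → decode (encode x) ≡ x
  decode-encode = Inverse.strictlyInverseʳ symbolIndex

  symbol : Fin m′ → Fin m
  symbol = proj₁ ∘ decode

  label : Fin m′ → State
  label = proj₂ ∘ decode

  annotate : State → List (Fin m) → List (Fin m′)
  annotate s []      = []
  annotate s (X ∷ β) = encode (X , readFrom s β) ∷ annotate s β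

  symbols-annotate : ∀ s α → map symbol (annotate s α) ≡ α
  symbols-annotate s []      = refl
  symbols-annotate s (X ∷ α) = cong₂ _∷_ (cong proj₁ (decode-encode _)) (symbols-annotate s α)

  annotate-++ : ∀ s α γ → annotate s (α ++ γ) ≡ annotate (readFrom s γ) α ++ annotate s γ
  annotate-++ s []      γ = refl
  annotate-++ s (X ∷ α) γ =
    cong₂ _∷_ (cong (λ t → encode (X , t)) (readFrom-++ s α γ)) (annotate-++ s α γ)

  G : Config n m → Config n m′
  G (p , α) = p , annotate start α

  G-injective : Injective _≡_ _≡_ G
  G-injective {p , α} {q , β} eq = cong₂ _,_ (cong proj₁ eq) (begin
    α                              ≡⟨ sym (symbols-annotate start α) ⟩
    map symbol (annotate start α)  ≡⟨ cong (map symbol ∘ proj₂) eq ⟩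
    map symbol (annotate start β)  ≡⟨ symbols-annotate start β ⟩
    β                              ∎)

  lift : Rule n m → State → Rule n m′
  lift (rule p X q α) s = rule p (encode (X , s)) q (annotate s α)

  unlift : Rule n m′ → Rule n m
  unlift (rule p Y q α′) = rule p (symbol Y) q (map symbol α′)

  unlift-lift : ∀ r s → unlift (lift r s) ≡ r
  unlift-lift (rule p X q α) s =
    cong₂ (λ Y β → rule p Y q β) (cong proj₁ (decode-encode (X , s))) (symbols-annotate s α)

  label-lift : ∀ r s → label (Rule.top (lift r s)) ≡ s
  label-lift r s = cong proj₂ (decode-encode _)

  lift-injective : ∀ {r r′ s s′} → lift r s ≡ lift r′ s′ → r ≡ r′ × s ≡ s′
  lift-injective {r} {r′} {s} {s′} eq =
    trans (sym (unlift-lift r s)) (trans (cong unlift eq) (unlift-lift r′ s′)) ,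
    trans (sym (label-lift r s)) (trans (cong (label ∘ Rule.top) eq) (label-lift r′ s′))

  allStates : List State
  allStates = map (Inverse.from index) (allFin size)

  allStates-unique : Unique allStates
  allStates-unique = Unique.map⁺ (Injection.injective (↔⇒↣ (↔-sym index))) (Unique.allFin⁺ size)

  ∈-allStates : ∀ s → s ∈ allStates
  ∈-allStates s = subst (_∈ allStates) (Inverse.strictlyInverseʳ index s)
                     (∈-map⁺ (Inverse.from index) (∈-allFin (Inverse.to index s)))

  δ′ : List (Rule n m′)
  δ′ = cartesianProductWith lift δ allStates

  Prob′ : Rule n m′ → ℚ
  Prob′ = Prob ∘ unlift

  ∈-δ′⁻ : ∀ {r′} → r′ ∈ δ′ → unlift r′ ∈ δ × r′ ≡ lift (unlift r′) (label (Rule.top r′))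
  ∈-δ′⁻ r′∈ with ∈-cartesianProductWith⁻ lift δ allStates r′∈
  ... | r , s , r∈ , _ , refl =
    subst (_∈ δ) (sym (unlift-lift r s)) r∈ ,
    cong₂ lift (sym (unlift-lift r s)) (sym (label-lift r s))

  Matches : Fin n → ∀ {m} → Fin m → Rule n m → Set
  Matches p X r = Rule.src r ≡ p × Rule.top r ≡ X

  matches? : ∀ p {m} (X : Fin m) → Decidable (Matches p X)
  matches? p X r = (Rule.src r ≟ᶠ p) ×-dec (Rule.top r ≟ᶠ X)

  matches-lift : ∀ {p X s r s′} → Matches p (encode (X , s)) (lift r s′) → Matches p X r × s′ ≡ s
  matches-lift (src≡ , top≡) with ,-injective (trans (sym (decode-encode _)) (trans (cong decode top≡) (decode-encode _)))
  ... | X≡ , s≡ = (src≡ , X≡) , s≡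

  filter-lift : ∀ p X s r → filter (matches? p (encode (X , s))) (map (lift r) allStates)
                          ≡ map (λ r → lift r s) (filter (matches? p X) [ r ])
  filter-lift p X s r with matches? p X r
  ... | yes r-matches@(src≡ , top≡) =
    trans (filter-map-unique (matches? p (encode (X , s))) (lift r) allStates-unique (∈-allStates s)
                             (proj₂ ∘ matches-lift {p} {X} {s} {r}) (src≡ , cong (λ Z → encode (Z , s)) top≡))
          (cong (map (λ r → lift r s)) (sym (filter-accept (matches? p X) {xs = []} r-matches)))
  ... | no ¬matches =
    trans (filter-none (matches? p (encode (X , s)))
                       (All.map⁺ (All.universal (λ _ → ¬matches ∘ proj₁ ∘ matches-lift {p} {X} {s} {r}) allStates)))
          (cong (map (λ r → lift r s)) (sym (filter-reject (matches? p X) {xs = []} ¬matches)))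

  rulesFrom-lift : ∀ rs p X s → rulesFrom (cartesianProductWith lift rs allStates) p (encode (X , s))
                                ≡ map (λ r → lift r s) (rulesFrom rs p X)
  rulesFrom-lift []       p X s = refl
  rulesFrom-lift (r ∷ rs) p X s = begin
    filter P′ (map (lift r) allStates ++ cartesianProductWith lift rs allStates)
      ≡⟨ filter-++ P′ (map (lift r) allStates) _ ⟩
    filter P′ (map (lift r) allStates) ++ filter P′ (cartesianProductWith lift rs allStates)
      ≡⟨ cong₂ _++_ (filter-lift p X s r) (rulesFrom-lift rs p X s) ⟩
    map lift-s (filter P [ r ]) ++ map lift-s (filter P rs)
      ≡⟨ sym (map-++ lift-s (filter P [ r ]) (filter P rs)) ⟩
    map lift-s (filter P [ r ] ++ filter P rs)
      ≡⟨ cong (map lift-s) (sym (filter-++ P [ r ] rs)) ⟩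
    map lift-s (filter P (r ∷ rs))
      ∎
    where
    P′ = matches? p (encode (X , s))
    P  = matches? p X
    lift-s = λ r → lift r s

  Prob′-rulesFrom : ∀ p Y → map Prob′ (rulesFrom δ′ p Y) ≡ map Prob (rulesFrom δ p (symbol Y))
  Prob′-rulesFrom p Y = begin
    map Prob′ (rulesFrom δ′ p Y)
      ≡⟨ cong (map Prob′ ∘ rulesFrom δ′ p) (sym (Inverse.strictlyInverseˡ symbolIndex Y)) ⟩
    map Prob′ (rulesFrom δ′ p (encode (symbol Y , label Y)))
      ≡⟨ cong (map Prob′) (rulesFrom-lift δ p (symbol Y) (label Y)) ⟩
    map Prob′ (map (λ r → lift r (label Y)) (rulesFrom δ p (symbol Y)))
      ≡⟨ sym (map-∘ (rulesFrom δ p (symbol Y))) ⟩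
    map (λ r → Prob′ (lift r (label Y))) (rulesFrom δ p (symbol Y))
      ≡⟨ map-cong (λ r → cong Prob (unlift-lift r (label Y))) (rulesFrom δ p (symbol Y)) ⟩
    map Prob (rulesFrom δ p (symbol Y))
      ∎

  Δ′ : PPDA n m′
  Δ′ = record
    { δ        = δ′
    ; δ-unique = Unique.cartesianProductWith⁺ lift lift-injective δ-unique allStates-unique
    ; Prob     = Prob′
    ; Prob-pos = λ r′ r′∈ → Prob-pos (unlift r′) (proj₁ (∈-δ′⁻ r′∈))
    ; Prob-le1 = λ r′ r′∈ → Prob-le1 (unlift r′) (proj₁ (∈-δ′⁻ r′∈))
    ; Prob-sum = λ p Y → subst (λ ps → sumℚ ps ≡ 0ℚ ⊎ sumℚ ps ≡ 1ℚ)
                               (sym (Prob′-rulesFrom p Y)) (Prob-sum p (symbol Y))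
    }

  G-step⁺ : ∀ c x c′ → Step Δ c x c′ → Step Δ′ (G c) x (G c′)
  G-step⁺ _ _ _ (step {p} {X} {q} {α} γ r∈) =
    subst₂ (λ x α′ → Step Δ′ (G (p , X ∷ γ)) x (q , α′))
      (cong Prob (unlift-lift (rule p X q α) (read γ)))
      (sym (annotate-++ start α γ))
      (step (annotate start γ) (∈-cartesianProductWith⁺ lift r∈ (∈-allStates (read γ))))

  G-step⁻ : ∀ c x s → Step Δ′ (G c) x s → Σ (Config n m) λ c′ → Step Δ c x c′ × G c′ ≡ s
  G-step⁻ (p , []) _ _ ()
  G-step⁻ (p , X ∷ β) _ _ (step {q = q} {α = α′} _ r′∈) =
    (q , α ++ β) , subst (λ Z → Step Δ (p , Z ∷ β) (Prob′ r′) (q , α ++ β)) symbol≡ (step β r∈) , cong (q ,_) annotated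
    where
    Y  = encode (X , read β)
    r′ = rule p Y q α′
    α  = map symbol α′
    r∈ = proj₁ (∈-δ′⁻ r′∈)

    symbol≡ : symbol Y ≡ X
    symbol≡ = cong proj₁ (decode-encode (X , read β))

    label≡ : label Y ≡ read β
    label≡ = cong proj₂ (decode-encode (X , read β))

    annotated : annotate start (α ++ β) ≡ α′ ++ annotate start β
    annotated = begin
      annotate start (α ++ β)                   ≡⟨ annotate-++ start α β ⟩
      annotate (read β) α ++ annotate start β   ≡⟨ cong (λ s → annotate s α ++ annotate start β) (sym label≡) ⟩
      annotate (label Y) α ++ annotate start β  ≡⟨ cong ((_++ annotate start β) ∘ Rule.push) (sym (proj₂ (∈-δ′⁻ r′∈))) ⟩
      α′ ++ annotate start β                    ∎

  simple : (Fin n → Maybe (Fin m × State) → Bool) → Fin n → Maybe (Fin m′) → Bool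
  simple f p = f p ∘ Maybe.map decode

  SimpleSet-G : ∀ f p α → SimpleSet (simple f) (G (p , α)) ≡ (f p (peek α) ≡ true)
  SimpleSet-G f p []      = refl
  SimpleSet-G f p (X ∷ β) = cong (λ v → f p (just v) ≡ true) (decode-encode (X , read β))

  module Preimage (B : Automaton n m′) where
    open Automaton B using (extra; run; Acc) renaming (trans to transB)

    Pair : Set
    Pair = (Fin n ⊎ Fin extra) × State

    pairIndex : Pair ↔ Fin ((n + extra) * size)
    pairIndex = index-× (↔-sym +↔⊎) index

    interpret : Fin n ⊎ Fin ((n + extra) * size) → Pair
    interpret (inj₁ p) = inj₁ p , start
    interpret (inj₂ i) = Inverse.from pairIndex i

    nextPair : Pair → Fin m → Pair
    nextPair (t , s) X = transB t (encode (X , s)) , next s X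

    preimage : Automaton n m
    preimage = record
      { extra = (n + extra) * size
      ; trans = λ t X → inj₂ (Inverse.to pairIndex (nextPair (interpret t) X))
      ; Acc   = Acc ∘ proj₁ ∘ interpret
      }

    interpret-run : ∀ p α → interpret (Automaton.run preimage (inj₁ p) (reverse α))
                            ≡ (run (inj₁ p) (reverse (annotate start α)) , read α)
    interpret-run p []      = refl
    interpret-run p (X ∷ β) = begin
      interpret (Automaton.run preimage (inj₁ p) (reverse (X ∷ β)))
        ≡⟨ cong interpret (run-reverse-∷ preimage (inj₁ p) X β) ⟩
      Inverse.from pairIndex (Inverse.to pairIndex (nextPair (interpret (Automaton.run preimage (inj₁ p) (reverse β))) X))
        ≡⟨ Inverse.strictlyInverseʳ pairIndex _ ⟩
      nextPair (interpret (Automaton.run preimage (inj₁ p) (reverse β))) X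
        ≡⟨ cong (λ t → nextPair t X) (interpret-run p β) ⟩
      transB (run (inj₁ p) (reverse (annotate start β))) (encode (X , read β)) , read (X ∷ β)
        ≡⟨ cong (_, read (X ∷ β)) (sym (run-reverse-∷ B (inj₁ p) (encode (X , read β)) (annotate start β))) ⟩
      run (inj₁ p) (reverse (annotate start (X ∷ β))) , read (X ∷ β)
        ∎

    Recognizes-preimage : ∀ c → Recognizes preimage c ≡ Recognizes B (G c)
    Recognizes-preimage (p , α) = cong (λ z → Acc (proj₁ z) ≡ true) (interpret-run p α)

  Regular-preimage : ∀ (D : Config n m′ → Set) → Regular D → Regular (λ c → D (G c))
  Regular-preimage D (B , D⇔B) =
    Preimage.preimage B , λ c → subst (D (G c) ⇔_) (sym (Preimage.Recognizes-preimage B c)) (D⇔B (G c))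

module _ {n m k : ℕ} (A : Fin k → Automaton n m) where

  runs : DFA m
  runs = ⨂ λ j → ⨂ λ r → startedAt (A j) (inj₁ r)

  runs-component : ∀ j p β → component _ p (component _ j (DFA.read runs β))
                             ≡ Automaton.run (A j) (inj₁ p) (reverse β)
  runs-component j p β = begin
    component _ p (component _ j (DFA.read runs β))      ≡⟨ cong (component _ p) (read-⨂ _ j β) ⟩
    component _ p (DFA.read (⨂ λ r → startedAt (A j) (inj₁ r)) β) ≡⟨ read-⨂ _ p β ⟩
    DFA.read (startedAt (A j) (inj₁ p)) β                ≡⟨ read-startedAt (A j) (inj₁ p) β ⟩
    Automaton.run (A j) (inj₁ p) (reverse β)             ∎

  accept : Fin k → Fin n → Maybe (Fin m × DFA.State runs) → Bool
  accept j p nothing       = Automaton.Acc (A j) (inj₁ p)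
  accept j p (just (X , s)) = Automaton.Acc (A j) (Automaton.trans (A j) (component _ p (component _ j s)) X)

  Recognizes-accept : ∀ j p α → Recognizes (A j) (p , α) ≡ (accept j p (DFA.peek runs α) ≡ true)
  Recognizes-accept j p []      = refl
  Recognizes-accept j p (X ∷ β) = cong (λ t → Automaton.Acc (A j) t ≡ true) (begin
    Automaton.run (A j) (inj₁ p) (reverse (X ∷ β))
      ≡⟨ run-reverse-∷ (A j) (inj₁ p) X β ⟩
    Automaton.trans (A j) (Automaton.run (A j) (inj₁ p) (reverse β)) X
      ≡⟨ cong (λ t → Automaton.trans (A j) t X) (sym (runs-component j p β)) ⟩
    Automaton.trans (A j) (component _ p (component _ j (DFA.read runs β))) X
      ∎)

lemma2p5 : ∀ {n m k} (Δ : PPDA n m) (C : Fin k → Config n m → Set) →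
    (∀ j → Regular (C j)) →
    Σ ℕ λ m′ → Σ (PPDA n m′) λ Δ′ →
    Σ (Fin k → Fin n → Maybe (Fin m′) → Bool) λ C′ →
    Σ (Config n m → Config n m′) λ G →
    Injective _≡_ _≡_ G
    × (∀ j c → C j c ⇔ SimpleSet (C′ j) (G c))
    × (∀ c x c′ → Step Δ c x c′ → Step Δ′ (G c) x (G c′))
    × (∀ c x s → Step Δ′ (G c) x s → Σ (Config n m) λ c′ → Step Δ c x c′ × G c′ ≡ s)
    × (∀ (D : Config n m′ → Set) → Regular D → Regular (λ c → D (G c)))
lemma2p5 Δ C reg =
  m′ , Δ′ , (λ j → simple (accept A j)) , G , G-injective , membership , G-step⁺ , G-step⁻ , Regular-preimage
  where
  A = λ j → proj₁ (reg j)
  open Annotation Δ (runs A)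

  membership : ∀ j c → C j c ⇔ SimpleSet (simple (accept A j)) (G c)
  membership j (p , α) =
    subst (C j (p , α) ⇔_)
          (trans (Recognizes-accept A j p α) (sym (SimpleSet-G (accept A j) p α)))
          (proj₂ (reg j) (p , α))
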